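{- For any finite simple graph $G$, $$|\operatorname{nucleus}(G)|+|\operatorname{diadem}(G)|\le 2\alpha(G)\le |\operatorname{core}(G)|+|\operatorname{corona}(G)|.$$
   Context: A set is independent if no two of its vertices are adjacent; $\alpha(G)$ is the maximum size of an independent set. $\operatorname{core}(G)$ is the intersection, and $\operatorname{corona}(G)$ the union, of all maximum independent sets of $G$. For $X\subseteq V(G)$, $N(X)$ is the set of neighbors of $X$ and $d(X)=|X|-|N(X)|$. An independent set $A$ is critical if $d(A)=\max\{d(Y):Y\subseteq V(G)\}$; the empty set may be critical. A maximum critical independent set is a critical independent set of maximum cardinality. $\operatorname{diadem}(G)$ is the union, and $\operatorname{nucleus}(G)$ the intersection, of all maximum critical independent sets of $G$ (both empty if $\emptyset$ is the only critical independent set). -}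

module Defs where

open import Data.Nat using (ℕ; zero; suc; _≤_)
open import Data.Bool using (Bool; true; false; _∧_; _∨_)
open import Data.Fin using (Fin; zero; suc)
open import Data.Fin.Subset using (Subset; _∈_; ∣_∣)
open import Data.Vec using (tabulate; lookup)
open import Data.Integer as ℤ using (ℤ; +_; _-_)
open import Data.Product using (Σ; _×_; _,_)
open import Relation.Binary.PropositionalEquality using (_≡_)
open import Function.Bundles using (_⇔_)

record Graph (n : ℕ) : Set where
  field
    adj    : Fin n → Fin n → Bool
    sym    : ∀ x y → adj x y ≡ adj y x
    irrefl : ∀ x → adj x x ≡ false
open Graph public

anyFin : ∀ {n} → (Fin n → Bool) → Bool
anyFin {zero}  p = false
anyFin {suc n} p = p zero ∨ anyFin (λ x → p (suc x))

module _ {n : ℕ} (G : Graph n) where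

  Independent : Subset n → Set
  Independent S = ∀ x y → x ∈ S → y ∈ S → adj G x y ≡ false

  MaxIndependent : Subset n → Set
  MaxIndependent S = Independent S × (∀ T → Independent T → ∣ T ∣ ≤ ∣ S ∣)

  IsAlpha : ℕ → Set
  IsAlpha a = Σ (Subset n) (λ S → Independent S × ∣ S ∣ ≡ a)
              × (∀ T → Independent T → ∣ T ∣ ≤ a)

  N : Subset n → Subset n
  N X = tabulate (λ y → anyFin (λ x → lookup X x ∧ adj G x y))

  d : Subset n → ℤ
  d X = + ∣ X ∣ - + ∣ N X ∣

  CriticalIndependent : Subset n → Set
  CriticalIndependent A = Independent A × (∀ Y → d Y ℤ.≤ d A)

  MaxCriticalIndependent : Subset n → Set
  MaxCriticalIndependent A =
    CriticalIndependent A × (∀ B → CriticalIndependent B → ∣ B ∣ ≤ ∣ A ∣)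

  IsCore : Subset n → Set
  IsCore C = ∀ x → (x ∈ C) ⇔ (∀ S → MaxIndependent S → x ∈ S)

  IsCorona : Subset n → Set
  IsCorona K = ∀ x → (x ∈ K) ⇔ Σ (Subset n) (λ S → MaxIndependent S × x ∈ S)

  IsNucleus : Subset n → Set
  IsNucleus U = ∀ x → (x ∈ U) ⇔ (∀ S → MaxCriticalIndependent S → x ∈ S)

  IsDiadem : Subset n → Set
  IsDiadem D = ∀ x → (x ∈ D) ⇔ Σ (Subset n) (λ S → MaxCriticalIndependent S × x ∈ S)

-- Fix a maximum critical independent set A.  Critical sets are closed under union (d is
-- supermodular) and B ─ N(A) stays critical, so A ∪ (B ─ N(A)) is critical independent for
-- every critical independent B; maximality of A then puts every vertex of the diadem outside A
-- into N(A).  Criticality of A yields Hall's condition |W| ≤ |A ∩ N(W)| for W ⊆ N(A).  Taking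
-- W = diadem ─ A, the nucleus lies in A and misses N(W), whence
-- |nucleus| + |diadem| ≤ |A| + |A| ≤ 2α.
--
-- For the other inequality let X and Y be the intersection and the union of some maximum
-- independent sets and S another one.  Since (S ─ N(X ─ S)) ∪ (X ─ S) is independent,
-- |X ─ S| ≤ |S ∩ N(X ─ S)| ≤ |S ─ Y|, so |X| + |Y| does not decrease when X, Y are replaced by
-- S ∩ X, S ∪ Y.  Starting from |S₀| + |S₀| = 2α and running through all maximum independent
-- sets ends at core and corona.

module Submission where

open import Defs hiding (sym)
open import Data.Nat using (ℕ; zero; suc; _+_; _*_; _≤_)
open import Data.Nat.Properties as ℕ
  using ( +-suc; +-comm; +-assoc; +-identityʳ; +-cancelˡ-≤; +-mono-≤; +-monoˡ-≤; +-monoʳ-≤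
        ; <⇒≱; ≤-reflexive)
open import Data.Bool using (Bool; true; false; _∧_)
open import Data.Bool.Properties using (¬-not) renaming (_≟_ to _≟ᵇ_)
open import Data.Fin using (Fin; zero; suc)
open import Data.Fin.Properties using (all?)
open import Data.Fin.Subset
  using (Subset; _∈_; _∉_; _⊆_; ∣_∣; _∩_; _∪_; _─_; ⋂; ⋃; inside; outside; ⊥)
open import Data.Fin.Subset.Properties
  using ( _∈?_; x∈p∩q⁺; x∈p∩q⁻; x∈p∪q⁺; x∈p∪q⁻; p∩q⊆p; p∩q⊆q; p⊆p∪q; p─q⊆p
        ; x∈p∧x∉q⇒x∈p─q; ∉⊥; Empty-unique; ∣⊥∣≡0; p⊆q⇒∣p∣≤∣q∣; p⊂q⇒∣p∣<∣q∣
        ; ∣p∩q∣≤∣q∣; ∩-comm; ∩-identityʳ; ∪-identityʳ; ⊆-refl)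
import Data.Integer as ℤ
import Data.Integer.Properties as ℤ
open import Data.Integer.Tactic.RingSolver using (solve-∀)
open import Data.List using (List; []; _∷_; map; _++_; filter)
import Data.List.Membership.Propositional as List
open import Data.List.Membership.Propositional.Properties using (∈-map⁺; ∈-++⁺ˡ; ∈-++⁺ʳ; ∈-filter⁺)
open import Data.List.Relation.Unary.All as All using (All; []; _∷_)
open import Data.List.Relation.Unary.All.Properties using (all-filter)
open import Data.List.Relation.Unary.Any as Any using (Any; here; there)
open import Data.List.Extrema using (argmax; f[xs]≤f[argmax]; argmax-all)
open import Data.Vec as Vec using ([]; _∷_; lookup)
open import Data.Vec.Properties using (lookup∘tabulate; []=⇒lookup; lookup⇒[]=)
open import Data.Product using (∃; ∃-syntax; _×_; _,_; proj₁; proj₂)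
open import Data.Sum using (inj₁; inj₂)
open import Data.Unit using (tt)
open import Data.Empty using (⊥-elim)
open import Function using (_∘_)
open import Function.Bundles using (_⇔_; mk⇔; Equivalence)
open import Relation.Binary.Bundles using (TotalOrder)
open import Relation.Binary.PropositionalEquality
open import Relation.Nullary using (yes)
open import Relation.Nullary.Decidable using (_×-dec_; _→-dec_; decidable-stable)
import Relation.Nullary.Decidable as Dec
open import Relation.Unary using (Pred; Decidable)

-- Cardinalities of subsets

Disjoint : ∀ {n} → Subset n → Subset n → Set
Disjoint p q = ∀ {x} → x ∈ p → x ∉ q

x∈p─q⇒x∉q : ∀ {n} (p q : Subset n) → Disjoint (p ─ q) q
x∈p─q⇒x∉q (s ∷ p) (inside  ∷ q) {zero}  ()
x∈p─q⇒x∉q (s ∷ p) (outside ∷ q) {zero}  _ ()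
x∈p─q⇒x∉q (s ∷ p) (t ∷ q)       {suc x} (Vec.there x∈p─q) (Vec.there x∈q) = x∈p─q⇒x∉q p q x∈p─q x∈q

∣p∣≡∣p∩q∣+∣p─q∣ : ∀ {n} (p q : Subset n) → ∣ p ∣ ≡ ∣ p ∩ q ∣ + ∣ p ─ q ∣
∣p∣≡∣p∩q∣+∣p─q∣ []            []            = refl
∣p∣≡∣p∩q∣+∣p─q∣ (outside ∷ p) (inside  ∷ q) = ∣p∣≡∣p∩q∣+∣p─q∣ p q
∣p∣≡∣p∩q∣+∣p─q∣ (outside ∷ p) (outside ∷ q) = ∣p∣≡∣p∩q∣+∣p─q∣ p q
∣p∣≡∣p∩q∣+∣p─q∣ (inside  ∷ p) (inside  ∷ q) = cong suc (∣p∣≡∣p∩q∣+∣p─q∣ p q)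
∣p∣≡∣p∩q∣+∣p─q∣ (inside  ∷ p) (outside ∷ q) =
  trans (cong suc (∣p∣≡∣p∩q∣+∣p─q∣ p q)) (sym (+-suc _ _))

∣p∪q∣+∣p∩q∣≡∣p∣+∣q∣ : ∀ {n} (p q : Subset n) → ∣ p ∪ q ∣ + ∣ p ∩ q ∣ ≡ ∣ p ∣ + ∣ q ∣
∣p∪q∣+∣p∩q∣≡∣p∣+∣q∣ []            []            = refl
∣p∪q∣+∣p∩q∣≡∣p∣+∣q∣ (outside ∷ p) (outside ∷ q) = ∣p∪q∣+∣p∩q∣≡∣p∣+∣q∣ p q
∣p∪q∣+∣p∩q∣≡∣p∣+∣q∣ (inside  ∷ p) (outside ∷ q) = cong suc (∣p∪q∣+∣p∩q∣≡∣p∣+∣q∣ p q)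
∣p∪q∣+∣p∩q∣≡∣p∣+∣q∣ (outside ∷ p) (inside  ∷ q) =
  trans (cong suc (∣p∪q∣+∣p∩q∣≡∣p∣+∣q∣ p q)) (sym (+-suc _ _))
∣p∪q∣+∣p∩q∣≡∣p∣+∣q∣ (inside  ∷ p) (inside  ∷ q) =
  cong suc (trans (+-suc _ _) (trans (cong suc (∣p∪q∣+∣p∩q∣≡∣p∣+∣q∣ p q)) (sym (+-suc _ _))))

∣p∪q∣≡∣p─q∣+∣q∣ : ∀ {n} (p q : Subset n) → ∣ p ∪ q ∣ ≡ ∣ p ─ q ∣ + ∣ q ∣
∣p∪q∣≡∣p─q∣+∣q∣ []            []            = refl
∣p∪q∣≡∣p─q∣+∣q∣ (outside ∷ p) (outside ∷ q) = ∣p∪q∣≡∣p─q∣+∣q∣ p q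
∣p∪q∣≡∣p─q∣+∣q∣ (inside  ∷ p) (outside ∷ q) = cong suc (∣p∪q∣≡∣p─q∣+∣q∣ p q)
∣p∪q∣≡∣p─q∣+∣q∣ (outside ∷ p) (inside  ∷ q) =
  trans (cong suc (∣p∪q∣≡∣p─q∣+∣q∣ p q)) (sym (+-suc _ _))
∣p∪q∣≡∣p─q∣+∣q∣ (inside  ∷ p) (inside  ∷ q) =
  trans (cong suc (∣p∪q∣≡∣p─q∣+∣q∣ p q)) (sym (+-suc _ _))

module _ {n : ℕ} where

  disjoint-sym : {p q : Subset n} → Disjoint p q → Disjoint q p
  disjoint-sym p#q x∈q x∈p = p#q x∈p x∈q

  disjoint-⊆ : {p p′ q q′ : Subset n} → Disjoint p q → p′ ⊆ p → q′ ⊆ q → Disjoint p′ q′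
  disjoint-⊆ p#q p′⊆p q′⊆q x∈p′ x∈q′ = p#q (p′⊆p x∈p′) (q′⊆q x∈q′)

  disjoint⇒∣p∪q∣≡∣p∣+∣q∣ : (p q : Subset n) → Disjoint p q → ∣ p ∪ q ∣ ≡ ∣ p ∣ + ∣ q ∣
  disjoint⇒∣p∪q∣≡∣p∣+∣q∣ p q p#q = begin
    ∣ p ∪ q ∣               ≡⟨ +-identityʳ _ ⟨
    ∣ p ∪ q ∣ + 0           ≡⟨ cong (∣ p ∪ q ∣ +_) (∣⊥∣≡0 n) ⟨
    ∣ p ∪ q ∣ + ∣ ⊥ {n} ∣   ≡⟨ cong (λ r → ∣ p ∪ q ∣ + ∣ r ∣) p∩q≡⊥ ⟨
    ∣ p ∪ q ∣ + ∣ p ∩ q ∣   ≡⟨ ∣p∪q∣+∣p∩q∣≡∣p∣+∣q∣ p q ⟩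
    ∣ p ∣ + ∣ q ∣           ∎
    where
    open ≡-Reasoning
    p∩q≡⊥ : p ∩ q ≡ ⊥ {n}
    p∩q≡⊥ = Empty-unique λ (x , x∈p∩q) → let (x∈p , x∈q) = x∈p∩q⁻ p q x∈p∩q in p#q x∈p x∈q

  disjoint⇒∣p∣+∣q∣≤∣r∣ : {p q r : Subset n} → Disjoint p q → p ⊆ r → q ⊆ r → ∣ p ∣ + ∣ q ∣ ≤ ∣ r ∣
  disjoint⇒∣p∣+∣q∣≤∣r∣ {p} {q} {r} p#q p⊆r q⊆r =
    subst (_≤ ∣ r ∣) (disjoint⇒∣p∪q∣≡∣p∣+∣q∣ p q p#q) (p⊆q⇒∣p∣≤∣q∣ p∪q⊆r)
    where
    p∪q⊆r : p ∪ q ⊆ r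
    p∪q⊆r x∈p∪q with x∈p∪q⁻ p q x∈p∪q
    ... | inj₁ x∈p = p⊆r x∈p
    ... | inj₂ x∈q = q⊆r x∈q

  ⋂⊆ : (L : List (Subset n)) → All (⋂ L ⊆_) L
  ⋂⊆ []      = []
  ⋂⊆ (p ∷ L) = p∩q⊆p p (⋂ L) ∷ All.map (λ ⋂L⊆q {x} x∈ → ⋂L⊆q (p∩q⊆q p (⋂ L) x∈)) (⋂⊆ L)

  x∈⋃⁻ : ∀ {x} (L : List (Subset n)) → x ∈ ⋃ L → Any (x ∈_) L
  x∈⋃⁻ []      x∈⊥   = ⊥-elim (∉⊥ x∈⊥)
  x∈⋃⁻ (p ∷ L) x∈p∪⋃L with x∈p∪q⁻ p (⋃ L) x∈p∪⋃L
  ... | inj₁ x∈p  = here x∈p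
  ... | inj₂ x∈⋃L = there (x∈⋃⁻ L x∈⋃L)

subsets : ∀ n → List (Subset n)
subsets zero    = [] ∷ []
subsets (suc n) = map (inside ∷_) (subsets n) ++ map (outside ∷_) (subsets n)

∈-subsets : ∀ {n} (p : Subset n) → p List.∈ subsets n
∈-subsets []            = here refl
∈-subsets (inside  ∷ p) = ∈-++⁺ˡ (∈-map⁺ (inside ∷_) (∈-subsets p))
∈-subsets (outside ∷ p) = ∈-++⁺ʳ (map (inside ∷_) (subsets _)) (∈-map⁺ (outside ∷_) (∈-subsets p))

module _ {b ℓ₁ ℓ₂} (O : TotalOrder b ℓ₁ ℓ₂) where
  open TotalOrder O using (Carrier) renaming (_≤_ to _≼_)

  maximal-subset : ∀ {n p} {P : Pred (Subset n) p} → Decidable P → (f : Subset n → Carrier) →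
                   ∃ P → ∃[ S ] P S × (∀ T → P T → f T ≼ f S)
  maximal-subset {n} P? f (S₀ , PS₀) =
    argmax O f S₀ Ss ,
    argmax-all O f PS₀ (all-filter P? (subsets n)) ,
    λ T PT → All.lookup (f[xs]≤f[argmax] O S₀ Ss) (∈-filter⁺ P? (∈-subsets T) PT)
    where
    Ss : List (Subset n)
    Ss = filter P? (subsets n)

-- Integer inequalities

i-j≤k-l⇔i+l≤k+j : ∀ i j k l → (i ℤ.- j ℤ.≤ k ℤ.- l) ⇔ (i ℤ.+ l ℤ.≤ k ℤ.+ j)
i-j≤k-l⇔i+l≤k+j i j k l = mk⇔
  (λ h → subst₂ ℤ._≤_ (add-j+l i j l) (add-j+l′ k l j) (ℤ.+-monoˡ-≤ (j ℤ.+ l) h))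
  (λ h → subst₂ ℤ._≤_ (sub-j+l i l j) (sub-j+l′ k j l) (ℤ.+-monoˡ-≤ (ℤ.- (j ℤ.+ l)) h))
  where
  add-j+l : ∀ i j l → i ℤ.- j ℤ.+ (j ℤ.+ l) ≡ i ℤ.+ l
  add-j+l = solve-∀
  add-j+l′ : ∀ k l j → k ℤ.- l ℤ.+ (j ℤ.+ l) ≡ k ℤ.+ j
  add-j+l′ = solve-∀
  sub-j+l : ∀ i l j → i ℤ.+ l ℤ.- (j ℤ.+ l) ≡ i ℤ.- j
  sub-j+l = solve-∀
  sub-j+l′ : ∀ k j l → k ℤ.+ j ℤ.- (j ℤ.+ l) ≡ k ℤ.- l
  sub-j+l′ = solve-∀

[+m]-[+n]≤[+o]-[+p]⇔m+p≤o+n : ∀ m n o p → (ℤ.+ m ℤ.- ℤ.+ n ℤ.≤ ℤ.+ o ℤ.- ℤ.+ p) ⇔ (m + p ≤ o + n)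
[+m]-[+n]≤[+o]-[+p]⇔m+p≤o+n m n o p = mk⇔
  (λ h → ℤ.drop‿+≤+ (subst₂ ℤ._≤_ (sym (ℤ.pos-+ m p)) (sym (ℤ.pos-+ o n)) (to h)))
  (λ h → from (subst₂ ℤ._≤_ (ℤ.pos-+ m p) (ℤ.pos-+ o n) (ℤ.+≤+ h)))
  where open Equivalence (i-j≤k-l⇔i+l≤k+j (ℤ.+ m) (ℤ.+ n) (ℤ.+ o) (ℤ.+ p))

i+k≤j+k⇒i≤j : ∀ i j k → i ℤ.+ k ℤ.≤ j ℤ.+ k → i ℤ.≤ j
i+k≤j+k⇒i≤j i j k h = subst₂ ℤ._≤_ (cancel i k) (cancel j k) (ℤ.+-monoˡ-≤ (ℤ.- k) h)
  where
  cancel : ∀ i k → i ℤ.+ k ℤ.+ ℤ.- k ≡ i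
  cancel = solve-∀

-- Neighbourhoods and independent sets

anyFin⁺ : ∀ {n} (p : Fin n → Bool) {x} → p x ≡ true → anyFin p ≡ true
anyFin⁺ p {zero}  px rewrite px = refl
anyFin⁺ p {suc x} px with p zero
... | true  = refl
... | false = anyFin⁺ (p ∘ suc) px

anyFin⁻ : ∀ {n} (p : Fin n → Bool) → anyFin p ≡ true → ∃[ x ] p x ≡ true
anyFin⁻ {zero}  p ()
anyFin⁻ {suc n} p h with p zero in p₀
... | true  = zero , p₀
... | false = let (x , px) = anyFin⁻ (p ∘ suc) h in suc x , px

∧≡true⁻ : ∀ {a b} → a ∧ b ≡ true → a ≡ true × b ≡ true
∧≡true⁻ {true} {true} refl = refl , refl

module _ {n : ℕ} (G : Graph n) where

  x∈N⁺ : ∀ {X u x} → u ∈ X → adj G u x ≡ true → x ∈ N G X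
  x∈N⁺ {X} {u} {x} u∈X ux = lookup⇒[]= x (N G X) (trans (lookup∘tabulate _ x)
    (anyFin⁺ (λ v → lookup X v ∧ adj G v x) (cong₂ _∧_ ([]=⇒lookup u∈X) ux)))

  x∈N⁻ : ∀ {X x} → x ∈ N G X → ∃[ u ] u ∈ X × adj G u x ≡ true
  x∈N⁻ {X} {x} x∈NX =
    let (u , h) = anyFin⁻ (λ v → lookup X v ∧ adj G v x)
                    (trans (sym (lookup∘tabulate _ x)) ([]=⇒lookup x∈NX))
        (u∈X , ux) = ∧≡true⁻ h
    in u , lookup⇒[]= u X u∈X , ux

  N-mono : ∀ {X Y} → X ⊆ Y → N G X ⊆ N G Y
  N-mono X⊆Y x∈NX = let (u , u∈X , ux) = x∈N⁻ x∈NX in x∈N⁺ (X⊆Y u∈X) ux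

  N-∪ : ∀ X Y → N G (X ∪ Y) ⊆ N G X ∪ N G Y
  N-∪ X Y x∈N[X∪Y] with x∈N⁻ x∈N[X∪Y]
  ... | u , u∈X∪Y , ux with x∈p∪q⁻ X Y u∈X∪Y
  ...   | inj₁ u∈X = x∈p∪q⁺ (inj₁ (x∈N⁺ u∈X ux))
  ...   | inj₂ u∈Y = x∈p∪q⁺ (inj₂ (x∈N⁺ u∈Y ux))

  N-∩ : ∀ X Y → N G (X ∩ Y) ⊆ N G X ∩ N G Y
  N-∩ X Y x∈N[X∩Y] = x∈p∩q⁺ (N-mono (p∩q⊆p X Y) x∈N[X∩Y] , N-mono (p∩q⊆q X Y) x∈N[X∩Y])

  disjoint-N : ∀ {X Y} → Disjoint X (N G Y) → Disjoint Y (N G X)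
  disjoint-N X#NY y∈Y y∈NX =
    let (x , x∈X , xy) = x∈N⁻ y∈NX in X#NY x∈X (x∈N⁺ y∈Y (trans (Graph.sym G _ _) xy))

  independent⇒disjoint-N : ∀ {S} → Independent G S → Disjoint S (N G S)
  independent⇒disjoint-N indS x∈S x∈NS with x∈N⁻ x∈NS
  ... | u , u∈S , ux with trans (sym ux) (indS u _ u∈S x∈S)
  ...   | ()

  disjoint-N⇒independent : ∀ {S} → Disjoint S (N G S) → Independent G S
  disjoint-N⇒independent S#NS x y x∈S y∈S = ¬-not λ xy → S#NS y∈S (x∈N⁺ x∈S xy)

  independent-⊆ : ∀ {S T} → S ⊆ T → Independent G T → Independent G S
  independent-⊆ S⊆T indT x y x∈S y∈S = indT x y (S⊆T x∈S) (S⊆T y∈S)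

  independent-∪ : ∀ {S T} → Independent G S → Independent G T → Disjoint S (N G T) →
                  Independent G (S ∪ T)
  independent-∪ {S} {T} indS indT S#NT = disjoint-N⇒independent S∪T#N[S∪T]
    where
    S∪T#N[S∪T] : Disjoint (S ∪ T) (N G (S ∪ T))
    S∪T#N[S∪T] x∈S∪T x∈N[S∪T] with x∈p∪q⁻ S T x∈S∪T | x∈p∪q⁻ (N G S) (N G T) (N-∪ S T x∈N[S∪T])
    ... | inj₁ x∈S | inj₁ x∈NS = independent⇒disjoint-N indS x∈S x∈NS
    ... | inj₁ x∈S | inj₂ x∈NT = S#NT x∈S x∈NT
    ... | inj₂ x∈T | inj₁ x∈NS = disjoint-N S#NT x∈T x∈NS
    ... | inj₂ x∈T | inj₂ x∈NT = independent⇒disjoint-N indT x∈T x∈NT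

  ─N-independent : ∀ X → Independent G (X ─ N G X)
  ─N-independent X = disjoint-N⇒independent λ x∈X─NX x∈N[X─NX] →
    x∈p─q⇒x∉q X (N G X) x∈X─NX (N-mono (p─q⊆p X (N G X)) x∈N[X─NX])

  independent? : Decidable (Independent G)
  independent? S = all? λ x → all? λ y → (x ∈? S) →-dec ((y ∈? S) →-dec (adj G x y ≟ᵇ false))

  -- Critical sets

  Critical : Subset n → Set
  Critical A = ∀ Y → d G Y ℤ.≤ d G A

  d≤d⇔ : ∀ X Y → (d G X ℤ.≤ d G Y) ⇔ (∣ X ∣ + ∣ N G Y ∣ ≤ ∣ Y ∣ + ∣ N G X ∣)
  d≤d⇔ X Y = [+m]-[+n]≤[+o]-[+p]⇔m+p≤o+n (∣ X ∣) (∣ N G X ∣) (∣ Y ∣) (∣ N G Y ∣)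

  d-supermodular : ∀ A B → d G A ℤ.+ d G B ℤ.≤ d G (A ∪ B) ℤ.+ d G (A ∩ B)
  d-supermodular A B = subst₂ ℤ._≤_ (sym (d+d A B)) (sym (d+d (A ∪ B) (A ∩ B)))
    (Equivalence.from ([+m]-[+n]≤[+o]-[+p]⇔m+p≤o+n
        (∣ A ∣ + ∣ B ∣) (∣ N G A ∣ + ∣ N G B ∣)
        (∣ A ∪ B ∣ + ∣ A ∩ B ∣) (∣ N G (A ∪ B) ∣ + ∣ N G (A ∩ B) ∣))
      (+-mono-≤ (≤-reflexive (sym (∣p∪q∣+∣p∩q∣≡∣p∣+∣q∣ A B))) ∣N[A∪B]∣+∣N[A∩B]∣≤∣NA∣+∣NB∣))
    where
    ∣N[A∪B]∣+∣N[A∩B]∣≤∣NA∣+∣NB∣ : ∣ N G (A ∪ B) ∣ + ∣ N G (A ∩ B) ∣ ≤ ∣ N G A ∣ + ∣ N G B ∣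
    ∣N[A∪B]∣+∣N[A∩B]∣≤∣NA∣+∣NB∣ = ℕ.≤-trans
      (+-mono-≤ (p⊆q⇒∣p∣≤∣q∣ (N-∪ A B)) (p⊆q⇒∣p∣≤∣q∣ (N-∩ A B)))
      (≤-reflexive (∣p∪q∣+∣p∩q∣≡∣p∣+∣q∣ (N G A) (N G B)))
    regroup : ∀ i j k l → i ℤ.- j ℤ.+ (k ℤ.- l) ≡ i ℤ.+ k ℤ.- (j ℤ.+ l)
    regroup = solve-∀
    d+d : ∀ X Y → d G X ℤ.+ d G Y ≡ ℤ.+ (∣ X ∣ + ∣ Y ∣) ℤ.- ℤ.+ (∣ N G X ∣ + ∣ N G Y ∣)
    d+d X Y = trans (regroup (ℤ.+ ∣ X ∣) (ℤ.+ ∣ N G X ∣) (ℤ.+ ∣ Y ∣) (ℤ.+ ∣ N G Y ∣))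
      (sym (cong₂ ℤ._-_ (ℤ.pos-+ ∣ X ∣ ∣ Y ∣) (ℤ.pos-+ ∣ N G X ∣ ∣ N G Y ∣)))

  critical-∪ : ∀ A B → Critical A → Critical B → Critical (A ∪ B)
  critical-∪ A B critA critB Y = ℤ.≤-trans (critA Y) (i+k≤j+k⇒i≤j (d G A) (d G (A ∪ B)) (d G B)
    (ℤ.≤-trans (d-supermodular A B) (ℤ.+-monoʳ-≤ (d G (A ∪ B)) (critB (A ∩ B)))))

  -- Criticality of A is tested on A ─ N(W), whose neighbourhood lies in N(A) and misses W.
  critical-hall : ∀ A W → Critical A → W ⊆ N G A → ∣ W ∣ ≤ ∣ A ∩ N G W ∣
  critical-hall A W critA W⊆NA = +-cancelˡ-≤ (∣ Y ∣ + ∣ N G Y ∣) _ _ (begin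
    ∣ Y ∣ + ∣ N G Y ∣ + ∣ W ∣            ≡⟨ +-assoc ∣ Y ∣ _ _ ⟩
    ∣ Y ∣ + (∣ N G Y ∣ + ∣ W ∣)          ≤⟨ +-monoʳ-≤ ∣ Y ∣ ∣NY∣+∣W∣≤∣NA∣ ⟩
    ∣ Y ∣ + ∣ N G A ∣                    ≤⟨ Equivalence.to (d≤d⇔ Y A) (critA Y) ⟩
    ∣ A ∣ + ∣ N G Y ∣                    ≡⟨ cong (_+ ∣ N G Y ∣) (∣p∣≡∣p∩q∣+∣p─q∣ A (N G W)) ⟩
    ∣ A ∩ N G W ∣ + ∣ Y ∣ + ∣ N G Y ∣    ≡⟨ +-assoc ∣ A ∩ N G W ∣ _ _ ⟩
    ∣ A ∩ N G W ∣ + (∣ Y ∣ + ∣ N G Y ∣)  ≡⟨ +-comm ∣ A ∩ N G W ∣ _ ⟩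
    ∣ Y ∣ + ∣ N G Y ∣ + ∣ A ∩ N G W ∣    ∎)
    where
    open ℕ.≤-Reasoning
    Y : Subset n
    Y = A ─ N G W
    ∣NY∣+∣W∣≤∣NA∣ : ∣ N G Y ∣ + ∣ W ∣ ≤ ∣ N G A ∣
    ∣NY∣+∣W∣≤∣NA∣ = disjoint⇒∣p∣+∣q∣≤∣r∣
      (disjoint-sym (disjoint-N (x∈p─q⇒x∉q A (N G W)))) (N-mono (p─q⊆p A (N G W))) W⊆NA

  -- B ∩ N(A) is no larger than A ∩ N(B ∩ N(A)), which lies in N(B) but outside N(B ─ N(A)).
  d≤d[─N] : ∀ A B → Critical A → d G B ℤ.≤ d G (B ─ N G A)
  d≤d[─N] A B critA = Equivalence.from (d≤d⇔ B B′) (begin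
    ∣ B ∣ + ∣ N G B′ ∣                      ≡⟨ cong (_+ ∣ N G B′ ∣) (∣p∣≡∣p∩q∣+∣p─q∣ B (N G A)) ⟩
    ∣ B₁ ∣ + ∣ B′ ∣ + ∣ N G B′ ∣            ≡⟨ cong (_+ ∣ N G B′ ∣) (+-comm ∣ B₁ ∣ _) ⟩
    ∣ B′ ∣ + ∣ B₁ ∣ + ∣ N G B′ ∣            ≡⟨ +-assoc ∣ B′ ∣ _ _ ⟩
    ∣ B′ ∣ + (∣ B₁ ∣ + ∣ N G B′ ∣)          ≤⟨ +-monoʳ-≤ ∣ B′ ∣ (+-monoˡ-≤ ∣ N G B′ ∣ ∣B₁∣≤∣A∩NB₁∣) ⟩
    ∣ B′ ∣ + (∣ A ∩ N G B₁ ∣ + ∣ N G B′ ∣)  ≤⟨ +-monoʳ-≤ ∣ B′ ∣ ∣A∩NB₁∣+∣NB′∣≤∣NB∣ ⟩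
    ∣ B′ ∣ + ∣ N G B ∣                      ∎)
    where
    open ℕ.≤-Reasoning
    B₁ B′ : Subset n
    B₁ = B ∩ N G A
    B′ = B ─ N G A
    ∣B₁∣≤∣A∩NB₁∣ : ∣ B₁ ∣ ≤ ∣ A ∩ N G B₁ ∣
    ∣B₁∣≤∣A∩NB₁∣ = critical-hall A B₁ critA (p∩q⊆q B (N G A))
    ∣A∩NB₁∣+∣NB′∣≤∣NB∣ : ∣ A ∩ N G B₁ ∣ + ∣ N G B′ ∣ ≤ ∣ N G B ∣
    ∣A∩NB₁∣+∣NB′∣≤∣NB∣ = disjoint⇒∣p∣+∣q∣≤∣r∣
      (disjoint-⊆ (disjoint-N (x∈p─q⇒x∉q B (N G A))) (p∩q⊆p A (N G B₁)) ⊆-refl)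
      (N-mono (p∩q⊆p B (N G A)) ∘ p∩q⊆q A (N G B₁))
      (N-mono (p─q⊆p B (N G A)))

  critical-─N : ∀ A B → Critical A → Critical B → Critical (B ─ N G A)
  critical-─N A B critA critB Y = ℤ.≤-trans (critB Y) (d≤d[─N] A B critA)

  criticalIndependent-∪─N : ∀ A B → CriticalIndependent G A → CriticalIndependent G B →
                            CriticalIndependent G (A ∪ (B ─ N G A))
  criticalIndependent-∪─N A B (indA , critA) (indB , critB) =
    independent-∪ indA (independent-⊆ (p─q⊆p B (N G A)) indB) (disjoint-N (x∈p─q⇒x∉q B (N G A))) ,
    critical-∪ A (B ─ N G A) critA (critical-─N A B critA critB)

  criticalIndependent-exists : ∃ (CriticalIndependent G)
  criticalIndependent-exists =
    let (X , _ , maxX) = maximal-subset ℤ.≤-totalOrder (λ _ → yes tt) (d G) (⊥ , tt)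
        critX Y = maxX Y tt
    in X ─ N G X , ─N-independent X , critical-─N X X critX critX

  -- For a fixed critical I, a set A is critical iff d(I) ≤ d(A), which is decidable.
  maxCriticalIndependent-exists : ∃ (MaxCriticalIndependent G)
  maxCriticalIndependent-exists =
    let (I , indI , critI) = criticalIndependent-exists
        (A , (indA , dI≤dA) , maxA) = maximal-subset ℕ.≤-totalOrder
          (λ A → independent? A ×-dec (d G I ℤ.≤? d G A)) ∣_∣ (I , indI , ℤ.≤-refl)
    in A , (indA , λ Y → ℤ.≤-trans (critI Y) dI≤dA) ,
       λ B (indB , critB) → maxA B (indB , critB I)

  maxCriticalIndependent-absorbs : ∀ {A B x} → MaxCriticalIndependent G A →
                                   CriticalIndependent G B → x ∈ B → x ∉ A → x ∈ N G A
  maxCriticalIndependent-absorbs {A} {B} {x} (ciA , maxA) ciB x∈B x∉A =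
    decidable-stable (x ∈? N G A) λ x∉NA →
      <⇒≱ (p⊂q⇒∣p∣<∣q∣ (p⊆p∪q (B ─ N G A) , x , x∈T x∉NA , x∉A)) 
        (maxA T (criticalIndependent-∪─N A B ciA ciB))
    where
    T : Subset n
    T = A ∪ (B ─ N G A)
    x∈T : x ∉ N G A → x ∈ T
    x∈T x∉NA = x∈p∪q⁺ (inj₂ (x∈p∧x∉q⇒x∈p─q x∈B x∉NA))

  ∣nucleus∣+∣diadem∣≤∣A∣+∣A∣ : ∀ {A U D} → MaxCriticalIndependent G A →
                            IsNucleus G U → IsDiadem G D → ∣ U ∣ + ∣ D ∣ ≤ ∣ A ∣ + ∣ A ∣
  ∣nucleus∣+∣diadem∣≤∣A∣+∣A∣ {A} {U} {D} mciA isU isD = begin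
    ∣ U ∣ + ∣ D ∣                        ≡⟨ cong (∣ U ∣ +_) (∣p∣≡∣p∩q∣+∣p─q∣ D A) ⟩
    ∣ U ∣ + (∣ D ∩ A ∣ + ∣ W ∣)          ≤⟨ +-monoʳ-≤ ∣ U ∣ (+-mono-≤ (∣p∩q∣≤∣q∣ D A) ∣W∣≤∣A∩NW∣) ⟩
    ∣ U ∣ + (∣ A ∣ + ∣ A ∩ N G W ∣)      ≡⟨ +-assoc ∣ U ∣ _ _ ⟨
    ∣ U ∣ + ∣ A ∣ + ∣ A ∩ N G W ∣        ≡⟨ cong (_+ ∣ A ∩ N G W ∣) (+-comm ∣ U ∣ _) ⟩
    ∣ A ∣ + ∣ U ∣ + ∣ A ∩ N G W ∣        ≡⟨ +-assoc ∣ A ∣ _ _ ⟩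
    ∣ A ∣ + (∣ U ∣ + ∣ A ∩ N G W ∣)      ≤⟨ +-monoʳ-≤ ∣ A ∣ ∣U∣+∣A∩NW∣≤∣A∣ ⟩
    ∣ A ∣ + ∣ A ∣                        ∎
    where
    open ℕ.≤-Reasoning
    W : Subset n
    W = D ─ A
    W⊆NA : W ⊆ N G A
    W⊆NA x∈W =
      let (B , (ciB , _) , x∈B) = Equivalence.to (isD _) (p─q⊆p D A x∈W)
      in maxCriticalIndependent-absorbs mciA ciB x∈B (x∈p─q⇒x∉q D A x∈W)
    ∣W∣≤∣A∩NW∣ : ∣ W ∣ ≤ ∣ A ∩ N G W ∣
    ∣W∣≤∣A∩NW∣ = critical-hall A W (proj₂ (proj₁ mciA)) W⊆NA
    U#NW : Disjoint U (N G W)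
    U#NW {u} u∈U u∈NW with x∈N⁻ u∈NW
    ... | w , w∈W , wu with Equivalence.to (isD w) (p─q⊆p D A w∈W)
    ...   | B , mciB , w∈B
      with trans (sym wu) (proj₁ (proj₁ mciB) w u w∈B (Equivalence.to (isU u) u∈U B mciB))
    ...   | ()
    ∣U∣+∣A∩NW∣≤∣A∣ : ∣ U ∣ + ∣ A ∩ N G W ∣ ≤ ∣ A ∣
    ∣U∣+∣A∩NW∣≤∣A∣ = disjoint⇒∣p∣+∣q∣≤∣r∣
      (disjoint-⊆ U#NW ⊆-refl (p∩q⊆q A (N G W)))
      (λ u∈U → Equivalence.to (isU _) u∈U A mciA)
      (p∩q⊆p A (N G W))

  -- Maximum independent sets

  -- (S ─ N(Z)) ∪ Z is independent, hence no larger than S.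
  maxIndependent-hall : ∀ {S Z} → MaxIndependent G S → Independent G Z → Disjoint Z S →
                        ∣ Z ∣ ≤ ∣ S ∩ N G Z ∣
  maxIndependent-hall {S} {Z} (indS , maxS) indZ Z#S = +-cancelˡ-≤ ∣ S′ ∣ _ _ (begin
    ∣ S′ ∣ + ∣ Z ∣          ≡⟨ disjoint⇒∣p∪q∣≡∣p∣+∣q∣ S′ Z S′#Z ⟨
    ∣ S′ ∪ Z ∣              ≤⟨ maxS (S′ ∪ Z) indS′∪Z ⟩
    ∣ S ∣                   ≡⟨ ∣p∣≡∣p∩q∣+∣p─q∣ S (N G Z) ⟩
    ∣ S ∩ N G Z ∣ + ∣ S′ ∣  ≡⟨ +-comm (∣ S ∩ N G Z ∣) _ ⟩
    ∣ S′ ∣ + ∣ S ∩ N G Z ∣  ∎)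
    where
    open ℕ.≤-Reasoning
    S′ : Subset n
    S′ = S ─ N G Z
    S′#Z : Disjoint S′ Z
    S′#Z = disjoint-sym (disjoint-⊆ Z#S ⊆-refl (p─q⊆p S (N G Z)))
    indS′∪Z : Independent G (S′ ∪ Z)
    indS′∪Z = independent-∪ (independent-⊆ (p─q⊆p S (N G Z)) indS) indZ (x∈p─q⇒x∉q S (N G Z))

  ∣X∣+∣Y∣≤∣S∩X∣+∣S∪Y∣ : ∀ {S X Y} → MaxIndependent G S → Independent G X →
                        (∀ {y} → y ∈ Y → ∃[ T ] (MaxIndependent G T × X ⊆ T) × y ∈ T) →
                        ∣ X ∣ + ∣ Y ∣ ≤ ∣ S ∩ X ∣ + ∣ S ∪ Y ∣
  ∣X∣+∣Y∣≤∣S∩X∣+∣S∪Y∣ {S} {X} {Y} mS indX cover = begin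
    ∣ X ∣ + ∣ Y ∣                  ≡⟨ cong (_+ ∣ Y ∣) (∣p∣≡∣p∩q∣+∣p─q∣ X S) ⟩
    ∣ X ∩ S ∣ + ∣ Z ∣ + ∣ Y ∣      ≤⟨ +-monoˡ-≤ ∣ Y ∣ (+-monoʳ-≤ ∣ X ∩ S ∣ ∣Z∣≤∣S─Y∣) ⟩
    ∣ X ∩ S ∣ + ∣ S ─ Y ∣ + ∣ Y ∣  ≡⟨ +-assoc ∣ X ∩ S ∣ _ _ ⟩
    ∣ X ∩ S ∣ + (∣ S ─ Y ∣ + ∣ Y ∣) ≡⟨ cong₂ _+_ (cong ∣_∣ (∩-comm S X)) (∣p∪q∣≡∣p─q∣+∣q∣ S Y) ⟨
    ∣ S ∩ X ∣ + ∣ S ∪ Y ∣          ∎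
    where
    open ℕ.≤-Reasoning
    Z : Subset n
    Z = X ─ S
    Y#NZ : Disjoint Y (N G Z)
    Y#NZ y∈Y y∈NZ with cover y∈Y | x∈N⁻ y∈NZ
    ... | T , ((indT , _) , X⊆T) , y∈T | z , z∈Z , zy
      with trans (sym zy) (indT z _ (X⊆T (p─q⊆p X S z∈Z)) y∈T)
    ... | ()
    ∣Z∣≤∣S─Y∣ : ∣ Z ∣ ≤ ∣ S ─ Y ∣
    ∣Z∣≤∣S─Y∣ = ℕ.≤-trans
      (maxIndependent-hall mS (independent-⊆ (p─q⊆p X S) indX) (x∈p─q⇒x∉q X S))
      (p⊆q⇒∣p∣≤∣q∣ λ x∈S∩NZ →
        x∈p∧x∉q⇒x∈p─q (p∩q⊆p S (N G Z) x∈S∩NZ) λ x∈Y → Y#NZ x∈Y (p∩q⊆q S (N G Z) x∈S∩NZ))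

  module _ {a : ℕ} (α : IsAlpha G a) where

    maxIndependent⇒∣S∣≡a : ∀ {S} → MaxIndependent G S → ∣ S ∣ ≡ a
    maxIndependent⇒∣S∣≡a {S} (indS , maxS) =
      let ((S₀ , indS₀ , ∣S₀∣≡a) , ∣indep∣≤a) = α
      in ℕ.≤-antisym (∣indep∣≤a S indS) (subst (_≤ ∣ S ∣) ∣S₀∣≡a (maxS S₀ indS₀))

    ∣S∣≡a⇒maxIndependent : ∀ {S} → Independent G S → ∣ S ∣ ≡ a → MaxIndependent G S
    ∣S∣≡a⇒maxIndependent {S} indS ∣S∣≡a =
      indS , λ T indT → subst (∣ T ∣ ≤_) (sym ∣S∣≡a) (proj₂ α T indT)

    maxIndependent? : Decidable (MaxIndependent G)
    maxIndependent? S = Dec.map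
      (mk⇔ (λ (indS , ∣S∣≡a) → ∣S∣≡a⇒maxIndependent indS ∣S∣≡a)
           (λ mS → proj₁ mS , maxIndependent⇒∣S∣≡a mS))
      (independent? S ×-dec (∣ S ∣ ℕ.≟ a))

    a+a≤∣⋂∣+∣⋃∣ : ∀ S L → All (MaxIndependent G) (S ∷ L) → a + a ≤ ∣ ⋂ (S ∷ L) ∣ + ∣ ⋃ (S ∷ L) ∣
    a+a≤∣⋂∣+∣⋃∣ S [] (mS ∷ []) = ≤-reflexive (sym (cong₂ _+_
      (trans (cong ∣_∣ (∩-identityʳ S)) (maxIndependent⇒∣S∣≡a mS))
      (trans (cong ∣_∣ (∪-identityʳ S)) (maxIndependent⇒∣S∣≡a mS))))
    a+a≤∣⋂∣+∣⋃∣ S (T ∷ L) (mS ∷ mTL) = ℕ.≤-trans (a+a≤∣⋂∣+∣⋃∣ T L mTL)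
      (∣X∣+∣Y∣≤∣S∩X∣+∣S∪Y∣ mS (independent-⊆ (p∩q⊆p T (⋂ L)) (proj₁ (All.head mTL))) cover)
      where
      cover : ∀ {y} → y ∈ ⋃ (T ∷ L) → ∃[ T′ ] (MaxIndependent G T′ × ⋂ (T ∷ L) ⊆ T′) × y ∈ T′
      cover y∈⋃ = let i = x∈⋃⁻ (T ∷ L) y∈⋃ in
        Any.lookup i , All.lookupAny (All.zip (mTL , ⋂⊆ (T ∷ L))) i

    a+a≤∣core∣+∣corona∣ : ∀ {C K} → IsCore G C → IsCorona G K → a + a ≤ ∣ C ∣ + ∣ K ∣
    a+a≤∣core∣+∣corona∣ {C} {K} isC isK = ℕ.≤-trans
      (a+a≤∣⋂∣+∣⋃∣ S₀ Ms mS₀Ms)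
      (+-mono-≤ (p⊆q⇒∣p∣≤∣q∣ ⋂⊆C) (p⊆q⇒∣p∣≤∣q∣ ⋃⊆K))
      where
      S₀ : Subset n
      S₀ = proj₁ (proj₁ α)
      Ms : List (Subset n)
      Ms = filter maxIndependent? (subsets n)
      mS₀Ms : All (MaxIndependent G) (S₀ ∷ Ms)
      mS₀Ms = let (_ , indS₀ , ∣S₀∣≡a) = proj₁ α in
        ∣S∣≡a⇒maxIndependent indS₀ ∣S₀∣≡a ∷ all-filter maxIndependent? (subsets n)
      ⋂⊆C : ⋂ (S₀ ∷ Ms) ⊆ C
      ⋂⊆C x∈⋂ = Equivalence.from (isC _) λ S mS →
        All.lookup (⋂⊆ (S₀ ∷ Ms)) (there (∈-filter⁺ maxIndependent? (∈-subsets S) mS)) x∈⋂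
      ⋃⊆K : ⋃ (S₀ ∷ Ms) ⊆ K
      ⋃⊆K x∈⋃ = let i = x∈⋃⁻ (S₀ ∷ Ms) x∈⋃ in
        Equivalence.from (isK _) (Any.lookup i , All.lookupAny mS₀Ms i)

corollary4p1 : (n : ℕ) (G : Graph n) (a : ℕ) (C K U D : Subset n)
    → IsAlpha G a → IsCore G C → IsCorona G K → IsNucleus G U → IsDiadem G D
    → (∣ U ∣ + ∣ D ∣ ≤ 2 * a) × (2 * a ≤ ∣ C ∣ + ∣ K ∣)
corollary4p1 n G a C K U D α isC isK isU isD =
  subst (∣ U ∣ + ∣ D ∣ ≤_) a+a≡2*a
    (ℕ.≤-trans (∣nucleus∣+∣diadem∣≤∣A∣+∣A∣ G mciA isU isD) (+-mono-≤ ∣A∣≤a ∣A∣≤a)) ,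
  subst (_≤ ∣ C ∣ + ∣ K ∣) a+a≡2*a (a+a≤∣core∣+∣corona∣ G α isC isK)
  where
  A : Subset n
  A = proj₁ (maxCriticalIndependent-exists G)
  mciA : MaxCriticalIndependent G A
  mciA = proj₂ (maxCriticalIndependent-exists G)
  ∣A∣≤a : ∣ A ∣ ≤ a
  ∣A∣≤a = proj₂ α A (proj₁ (proj₁ mciA))
  a+a≡2*a : a + a ≡ 2 * a
  a+a≡2*a = cong (a +_) (sym (+-identityʳ a))
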